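{- Let $X=\mathrm{Fl}(a,b;n)$, let $u,v,w$ be 012-strings for $X$ and $\mathbf{0}=(0^a,1^{b-a},2^{n-b})$. Then $C^w_{u,v}$ equals the number of rhombus-shaped puzzles whose top border reads $u$, right border reads $\mathbf{0}$, bottom border reads $v$ (these three in clockwise direction) and whose left border reads $w$ in counter-clockwise direction.
   Context: Labels are integers in $\{0,\dots,7\}$. A region subdivided into unit equilateral triangles (of the triangular lattice with horizontal edges) is filled into a puzzle by assigning labels to all unit edges so that for every unit triangle the three edge labels read clockwise around it form a cyclic rotation of one of $(0,0,0),(1,1,1),(2,2,2),(1,0,3),(2,1,4),(2,0,5),(2,3,6),(4,0,7)$. Triangular puzzles and $C^w_{u,v}$: for an equilateral triangle of side $n$ with horizontal bottom side, $C^w_{u,v}$ is the number of triangular puzzles whose left side read from bottom-left corner to top is $u$, right side read from top to bottom-right corner is $v$, and bottom side read from bottom-left to bottom-right corner is $w$. Rhombus shape: the rhombus of side $n$ with vertices $O=(0,0)$, $C=(n,0)$, $B=(n/2,\tfrac{\sqrt3}{2}n)$, $A=(-n/2,\tfrac{\sqrt3}{2}n)$ (horizontal top $AB$ and bottom $OC$, the top shifted to the left), subdivided into unit triangles. Reading directions: top border clockwise means from $A$ to $B$; right border clockwise from $B$ to $C$; bottom border clockwise from $C$ to $O$; left border counter-clockwise from $A$ to $O$. A 012-string for $\mathrm{Fl}(a,b;n)$ is a vector of length $n$ with $a$ zeros, $b-a$ ones and $n-b$ twos. -}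

module Defs where

open import Data.Bool using (Bool; true; false; _∧_; _∨_; if_then_else_)
open import Data.Nat using (ℕ; zero; suc; _+_; _∸_; _≤_; _<_; _<?_; _≤ᵇ_)
open import Data.Fin using (Fin; zero; suc; fromℕ<; _↑ˡ_; toℕ)
import Data.Fin as Fin
open import Data.List using (List; []; _∷_; map; concatMap; allFin; upTo; length; filterᵇ; cartesianProduct)
open import Data.Bool.ListAction using (all; any)
open import Data.Vec using (Vec; lookup; countᵇ)
open import Relation.Binary.PropositionalEquality using (_≡_)
open import Data.Product using (_×_; _,_)
open import Relation.Nullary using (does; yes; no)

Label : Set
Label = Fin 8

_==_ : Label → Label → Bool
x == y = does (x Fin.≟ y)

-- the eight basic triangles, edge labels read clockwise
basicTiles : List (Label × Label × Label)
basicTiles =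
    (# 0 , # 0 , # 0) ∷ (# 1 , # 1 , # 1) ∷ (# 2 , # 2 , # 2) ∷ (# 1 , # 0 , # 3)
  ∷ (# 2 , # 1 , # 4) ∷ (# 2 , # 0 , # 5) ∷ (# 2 , # 3 , # 6) ∷ (# 4 , # 0 , # 7) ∷ []
  where open Data.Fin using (#_)

eq3 : Label → Label → Label → Label × Label × Label → Bool
eq3 x y z (p , q , r) = (x == p) ∧ (y == q) ∧ (z == r)

allowed : Label → Label → Label → Bool
allowed x y z = any (λ t → eq3 x y z t ∨ eq3 y z x t ∨ eq3 z x y t) basicTiles

allPi : ∀ {n} {B : Fin n → Set} → ((i : Fin n) → List (B i)) → List ((i : Fin n) → B i)
allPi {zero}  {B} ls = (λ ()) ∷ []
allPi {suc n} {B} ls =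
  concatMap (λ b → map (λ f → cons b f) (allPi (λ i → ls (suc i)))) (ls zero)
  where
  cons : B zero → ((i : Fin n) → B (suc i)) → (i : Fin (suc n)) → B i
  cons b f zero    = b
  cons b f (suc i) = f i

Grid : ℕ → ℕ → Set
Grid m k = Fin m → Fin k → Label

allGrids : (m k : ℕ) → List (Grid m k)
allGrids m k = allPi (λ _ → allPi (λ _ → allFin 8))

-- read a grid at natural-number coordinates (0 outside the range; only used in range)
get : ∀ {m k} → Grid m k → ℕ → ℕ → Label
get {m} {k} g i j with i <? m | j <? k
... | yes p | yes q = g (fromℕ< p) (fromℕ< q)
... | _     | _     = zero

-- labels 0,1,2 of a 012-string as edge labels; entry at natural-number position
str : ∀ {n} → Vec (Fin 3) n → ℕ → Label
str {n} s k with k <? n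
... | yes p = lookup s (fromℕ< p) ↑ˡ 5
... | no  _ = zero

allBelow : ℕ → (ℕ → Bool) → Bool
allBelow n p = all p (upTo n)

is012String : (a b : ℕ) → ∀ {n} → Vec (Fin 3) n → Set
is012String a b {n} s =
    countᵇ (λ c → does (c Fin.≟ zero)) s ≡ a
  × countᵇ (λ c → does (c Fin.≟ suc zero)) s ≡ b ∸ a
  × countᵇ (λ c → does (c Fin.≟ suc (suc zero))) s ≡ n ∸ b

zeroString : (a b n : ℕ) → Vec (Fin 3) n
zeroString a b n = Data.Vec.tabulate (λ k →
  if suc (toℕ k) ≤ᵇ a then zero else if suc (toℕ k) ≤ᵇ b then suc zero else suc (suc zero))
  where import Data.Vec

-- Lattice point Q(i,j) = i·e1 + j·e2, e1 = (1,0), e2 = (1/2, √3/2);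
-- the triangle has corners Q(0,0), Q(n,0), Q(0,n).
-- Edge families, each indexed by (i,j) with i + j < n:
--   H i j : horizontal edge Q(i,j) — Q(i+1,j)
--   D i j : edge Q(i,j) — Q(i,j+1)     ("/")
--   A i j : edge Q(i+1,j) — Q(i,j+1)   ("\")
-- Entries with i + j ≥ n are not edges of the triangle; they are required
-- to be 0 so that labelings correspond bijectively to edge labelings.
-- Upward triangle at (i,j) (i+j ≤ n-1): clockwise  D i j, A i j, H i j.
-- Downward triangle at (i,j) (i+j ≤ n-2), corners Q(i,j+1), Q(i+1,j+1), Q(i+1,j):
--   clockwise  H i (j+1), D (i+1) j, A i j.

record TriLabeling (n : ℕ) : Set where
  constructor triLab
  field
    H D A : Grid n n

allTriLabelings : (n : ℕ) → List (TriLabeling n)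
allTriLabelings n =
  concatMap (λ h → concatMap (λ d → map (λ a → triLab h d a) (allGrids n n)) (allGrids n n))
            (allGrids n n)

-- u: left side bottom-to-top; v: right side top-to-bottom; w: bottom left-to-right
isTriPuzzle : ∀ {n} → (u v w : Vec (Fin 3) n) → TriLabeling n → Bool
isTriPuzzle {n} u v w (triLab H D A) =
    allBelow n (λ i → allBelow n (λ j →
      if n ≤ᵇ i + j
        then (get H i j == zero) ∧ (get D i j == zero) ∧ (get A i j == zero)
        else allowed (get D i j) (get A i j) (get H i j)))
  ∧ allBelow n (λ i → allBelow n (λ j →
      if suc (suc (i + j)) ≤ᵇ n
        then allowed (get H i (suc j)) (get D (suc i) j) (get A i j)
        else true))
  ∧ allBelow n (λ k →
        (get D 0 k == str u k)
      ∧ (get A k (n ∸ suc k) == str v k)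
      ∧ (get H k 0 == str w k))

C : ∀ {n} → (w u v : Vec (Fin 3) n) → ℕ
C {n} w u v = length (filterᵇ (isTriPuzzle u v w) (allTriLabelings n))

-- Lattice point P(x,y) = x·e1 + y·f, f = e2 − e1 = (−1/2, √3/2), 0 ≤ x,y ≤ n;
-- O = P(0,0), C = P(n,0), B = P(n,n), A = P(0,n).
-- Edge families:
--   Hr x y (x < n, y ≤ n) : horizontal edge P(x,y) — P(x+1,y)
--   Gr x y (x ≤ n, y < n) : edge P(x,y) — P(x,y+1)        ("\")
--   Dr x y (x < n, y < n) : edge P(x,y) — P(x+1,y+1)      ("/")
-- Each cell (x,y) is split by Dr x y into
--   upward triangle  P(x,y), P(x+1,y), P(x+1,y+1): clockwise Dr x y, Gr (x+1) y, Hr x y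
--   downward triangle P(x,y+1), P(x+1,y+1), P(x,y): clockwise Hr x (y+1), Dr x y, Gr x y.

record RhLabeling (n : ℕ) : Set where
  constructor rhLab
  field
    Hr : Grid n (suc n)
    Gr : Grid (suc n) n
    Dr : Grid n n

allRhLabelings : (n : ℕ) → List (RhLabeling n)
allRhLabelings n =
  concatMap (λ h → concatMap (λ g → map (λ d → rhLab h g d) (allGrids n n)) (allGrids (suc n) n))
            (allGrids n (suc n))

-- top (A→B) reads t, right (B→C) reads r, bottom (C→O) reads b,
-- left (A→O, counter-clockwise) reads l
isRhPuzzle : ∀ {n} → (t r b l : Vec (Fin 3) n) → RhLabeling n → Bool
isRhPuzzle {n} t r b l (rhLab Hr Gr Dr) =
    allBelow n (λ x → allBelow n (λ y →
        allowed (get Dr x y) (get Gr (suc x) y) (get Hr x y)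
      ∧ allowed (get Hr x (suc y)) (get Dr x y) (get Gr x y)))
  ∧ allBelow n (λ k →
        (get Hr k n == str t k)
      ∧ (get Gr n (n ∸ suc k) == str r k)
      ∧ (get Hr (n ∸ suc k) 0 == str b k)
      ∧ (get Gr 0 (n ∸ suc k) == str l k))

numRhPuzzles : ∀ {n} → (t r b l : Vec (Fin 3) n) → ℕ
numRhPuzzles {n} t r b l = length (filterᵇ (isRhPuzzle t r b l) (allRhLabelings n))

-- Cut the rhombus OCBA along its diagonal OB.  The triangle OAB carries u on AB and w on OA and
-- is a triangular puzzle whose third side is OB.  The triangle OCB carries v on OC and a sorted
-- word on CB, and it has exactly one filling: working line by line from CB towards O, every edge
-- label is forced by the tiles, and in the unique filling the x-th line parallel to CB carries,
-- sorted, the x letters of the bottom border nearest to O.  Along OB this filling reads v, so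
-- gluing along OB is a bijection between triangular puzzles with boundary (u, v, w) and rhombus
-- puzzles with boundary (u, sort v, v, w).  For a 012-string v of Fl(a,b;n), sort v is 0.
module Submission where

open import Defs
open import Data.Bool using (Bool; true; false; T; _∧_; if_then_else_)
open import Data.Bool.ListAction using (any)
open import Data.Bool.Properties using (T?; T-∧)
open import Data.Empty using (⊥-elim)
open import Data.Fin using (Fin; zero; suc; toℕ; fromℕ<; _↑ˡ_; #_) renaming (_≤_ to _≤ᶠ_)
import Data.Fin as Fin
open import Data.Fin.Properties using (all?; ≤fromℕ; toℕ<n; fromℕ<-toℕ; toℕ-fromℕ<)
open import Data.List using (List; []; _∷_; _++_; map; concatMap; length; filterᵇ; allFin; upTo)
open import Data.List.Membership.Propositional using (lose)
open import Data.List.Membership.Propositional.Properties using (∈-allFin)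
open import Data.List.Relation.Unary.All.Properties using (all⁺; all⁻; applyUpTo⁺₁; applyUpTo⁻)
open import Data.List.Relation.Unary.Any.Properties using (any⁺)
open import Data.Nat using (ℕ; zero; suc; _+_; _*_; _∸_; _≤_; _<_; _≤ᵇ_; _<ᵇ_; z≤n; s≤s; s<s⁻¹)
open import Data.Nat.Properties
open import Algebra.Properties.CommutativeSemigroup +-commutativeSemigroup
  using () renaming (interchange to +-interchange)
open import Data.Product using (_×_; _,_; proj₁; proj₂)
open import Data.Sum using (_⊎_; inj₁; inj₂; [_,_]′)
open import Data.Unit using (tt)
open import Data.Vec using (Vec; []; _∷_; lookup; tabulate; countᵇ)
open import Data.Vec.Properties using (tabulate-cong)
open import Function using (Equivalence; id)
open import Relation.Binary.PropositionalEquality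
open import Relation.Binary.Definitions using (tri<; tri≈; tri>)
open import Relation.Nullary using (Dec; does; yes; no)
open import Relation.Nullary.Decidable using (toWitness; dec-true; dec-false; _→-dec_)

record Admissible (x y z : Label) : Set where
  constructor admissible
  field isAllowed : T (allowed x y z)

admissible-rotate : ∀ {x y z} → Admissible x y z → Admissible y z x
admissible-rotate {x} {y} {z} (admissible p) =
  admissible (toWitness {a? = all? λ x → all? λ y → all? λ z →
  T? (allowed x y z) →-dec T? (allowed y z x)} tt x y z p)

admissible-injective₁ : ∀ {x x' y z} → Admissible x y z → Admissible x' y z → x ≡ x'
admissible-injective₁ {x} {x'} {y} {z} (admissible p) (admissible q) =
  toWitness {a? = all? λ x → all? λ x' → all? λ y → all? λ z →
  T? (allowed x y z) →-dec (T? (allowed x' y z) →-dec (x Fin.≟ x'))} tt x x' y z p q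

admissible-injective₃ : ∀ {x y z z'} → Admissible x y z → Admissible x y z' → z ≡ z'
admissible-injective₃ p q =
  admissible-injective₁ (admissible-rotate (admissible-rotate p)) (admissible-rotate (admissible-rotate q))

subst-admissible : ∀ {x x' y y' z z'} → x ≡ x' → y ≡ y' → z ≡ z' → Admissible x y z → Admissible x' y' z'
subst-admissible refl refl refl p = p


-- The rigid triangle OCB

pattern F0 = zero
pattern F1 = suc zero
pattern F2 = suc (suc zero)

label : Fin 3 → Label
label c = c ↑ˡ 5

-- In the unique filling of OCB, an up-triangle in the column above the bottom letter c whose
-- right edge carries s has diagonal edge diagonal c s and horizontal edge horizontal c s.
horizontal : Fin 3 → Fin 3 → Label
horizontal F2 F2 = # 2
horizontal F2 F1 = # 4
horizontal F2 F0 = # 5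
horizontal F1 F0 = # 3
horizontal F1 _  = # 1
horizontal F0 _  = # 0

diagonal : Fin 3 → Fin 3 → Label
diagonal F2 _  = # 2
diagonal F1 F2 = # 4
diagonal F1 _  = # 1
diagonal F0 F2 = # 5
diagonal F0 F1 = # 3
diagonal F0 F0 = # 0

up-admissible : ∀ c s → Admissible (diagonal c s) (label s) (horizontal c s)
up-admissible c s = admissible (toWitness {a? = all? λ c → all? λ s →
  T? (allowed (diagonal c s) (label s) (horizontal c s))} tt c s)

down-admissible : ∀ c s → Admissible (horizontal c s) (diagonal c s) (label s)
down-admissible c s = admissible (toWitness {a? = all? λ c → all? λ s →
  T? (allowed (horizontal c s) (diagonal c s) (label s))} tt c s)

completable : Label → Label → Bool
completable x y = any (allowed x y) (allFin 8)

admissible⇒completable : ∀ {x y z} → Admissible x y z → T (completable x y)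
admissible⇒completable {x} {y} {z} (admissible p) = any⁺ (allowed x y) (lose (∈-allFin z) p)

-- The hypothesis on the forced value is needed: for c = 1, s₀ = 2, s₁ = 0 the only solution is h = 7.
horizontal-forced : ∀ {c s₀ s₁ h l l' d} → s₁ ≤ᶠ s₀ → Admissible (horizontal c s₁) (diagonal c s₀) l' →
  Admissible h (diagonal c s₀) l → Admissible d (label s₁) h → h ≡ horizontal c s₁
horizontal-forced {c} {s₀} {s₁} {h} s₁≤s₀ forced p q =
  check c s₀ s₁ h s₁≤s₀ (admissible⇒completable p) (admissible⇒completable (admissible-rotate q))
    (admissible⇒completable forced)
  where
  check : ∀ c s₀ s₁ h → s₁ ≤ᶠ s₀ → T (completable h (diagonal c s₀)) → T (completable (label s₁) h) →
          T (completable (horizontal c s₁) (diagonal c s₀)) → h ≡ horizontal c s₁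
  check = toWitness {a? = all? λ c → all? λ s₀ → all? λ s₁ → all? λ h →
    (s₁ Fin.≤? s₀) →-dec (T? _ →-dec (T? _ →-dec (T? _ →-dec (h Fin.≟ horizontal c s₁))))} tt

sortedWord : ℕ → ℕ → ℕ → Fin 3
sortedWord (suc a) b       zero    = F2
sortedWord (suc a) b       (suc y) = sortedWord a b y
sortedWord zero    (suc b) zero    = F1
sortedWord zero    (suc b) (suc y) = sortedWord zero b y
sortedWord zero    zero    y       = F0

sortedWord-antitone : ∀ a b y → sortedWord a b (suc y) ≤ᶠ sortedWord a b y
sortedWord-antitone (suc a) b       zero    = ≤fromℕ _
sortedWord-antitone (suc a) b       (suc y) = sortedWord-antitone a b y
sortedWord-antitone zero    (suc zero)    zero = z≤n
sortedWord-antitone zero    (suc (suc b)) zero = s≤s z≤n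
sortedWord-antitone zero    (suc b) (suc y) = sortedWord-antitone zero b y
sortedWord-antitone zero    zero    y       = z≤n

sortedWord-2 : ∀ a b y → y < a → sortedWord a b y ≡ F2
sortedWord-2 (suc a) b zero    _       = refl
sortedWord-2 (suc a) b (suc y) (s≤s p) = sortedWord-2 a b y p

sortedWord-1 : ∀ a b y → a ≤ y → y < a + b → sortedWord a b y ≡ F1
sortedWord-1 (suc a) b       (suc y) (s≤s p) (s≤s q) = sortedWord-1 a b y p q
sortedWord-1 zero    (suc b) zero    _       _       = refl
sortedWord-1 zero    (suc b) (suc y) _       (s≤s q) = sortedWord-1 zero b y z≤n q

sortedWord-0 : ∀ a b y → a + b ≤ y → sortedWord a b y ≡ F0
sortedWord-0 (suc a) b       (suc y) (s≤s p) = sortedWord-0 a b y p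
sortedWord-0 zero    (suc b) (suc y) (s≤s p) = sortedWord-0 zero b y p
sortedWord-0 zero    zero    y       _       = refl

sortedWord-drop : ∀ a b y → a ≤ y → sortedWord a b y ≡ sortedWord zero b (y ∸ a)
sortedWord-drop zero    b y       _       = refl
sortedWord-drop (suc a) b (suc y) (s≤s p) = sortedWord-drop a b y p

horizontal₁-head : ∀ a b → horizontal F1 (sortedWord a (suc b) zero) ≡ # 1
horizontal₁-head zero    b = refl
horizontal₁-head (suc a) b = refl

diagonal₁-without-2 : ∀ b y → diagonal F1 (sortedWord zero b y) ≡ # 1
diagonal₁-without-2 zero    y       = refl
diagonal₁-without-2 (suc b) zero    = refl
diagonal₁-without-2 (suc b) (suc y) = diagonal₁-without-2 b y

-- inserting a 1 into 2^a 1^b shifts the word from position a on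
horizontal₁-insert : ∀ a b y → horizontal F1 (sortedWord a (suc b) (suc y)) ≡ horizontal F1 (sortedWord a b y)
horizontal₁-insert zero    b y       = refl
horizontal₁-insert (suc a) b zero    = horizontal₁-head a b
horizontal₁-insert (suc a) b (suc y) = horizontal₁-insert a b y

diagonal₁-insert : ∀ a b y → diagonal F1 (sortedWord a (suc b) y) ≡ diagonal F1 (sortedWord a b y)
diagonal₁-insert zero    b y       = trans (diagonal₁-without-2 (suc b) y) (sym (diagonal₁-without-2 b y))
diagonal₁-insert (suc a) b zero    = refl
diagonal₁-insert (suc a) b (suc y) = diagonal₁-insert a b y

𝟙 : Bool → ℕ
𝟙 true  = 1
𝟙 false = 0

𝟙-∧ : ∀ a b → 𝟙 (a ∧ b) ≡ 𝟙 a * 𝟙 b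
𝟙-∧ true  b = sym (+-identityʳ (𝟙 b))
𝟙-∧ false b = refl

tally : (ℕ → Fin 3) → Fin 3 → ℕ → ℕ
tally β c zero    = 0
tally β c (suc m) = 𝟙 (does (β m Fin.≟ c)) + tally β c m

tally-total : ∀ β m → tally β F2 m + tally β F1 m + tally β F0 m ≡ m
tally-total β zero = refl
tally-total β (suc m) with β m | tally-total β m
... | F0 | total = trans (+-suc (tally β F2 m + tally β F1 m) (tally β F0 m)) (cong suc total)
... | F1 | total = trans (cong (_+ tally β F0 m) (+-suc (tally β F2 m) (tally β F1 m))) (cong suc total)
... | F2 | total = cong suc total

≤-from-+-suc : ∀ m n k → m + suc n ≡ suc k → m ≤ k
≤-from-+-suc m n k eq = ≤-trans (m≤m+n m n) (≤-reflexive (suc-injective (trans (sym (+-suc m n)) eq)))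

Reading : Set
Reading = ℕ → ℕ → Label

module SortingTriangle (β : ℕ → Fin 3) where

  sorted : ℕ → ℕ → Fin 3
  sorted x = sortedWord (tally β F2 (suc x)) (tally β F1 (suc x))

  sorted-antitone : ∀ x y → sorted x (suc y) ≤ᶠ sorted x y
  sorted-antitone x = sortedWord-antitone (tally β F2 (suc x)) (tally β F1 (suc x))

  -- forcedG x is the line on the left of column x; forcedG 0 is junk and never used.
  forcedH forcedD forcedG : ℕ → ℕ → Label
  forcedH x y = horizontal (β x) (sorted x y)
  forcedD x y = diagonal (β x) (sorted x y)
  forcedG x y = label (sorted (x ∸ 1) y)

  forced-up : ∀ x y → Admissible (forcedD x y) (forcedG (suc x) y) (forcedH x y)
  forced-up x y = up-admissible (β x) (sorted x y)

  forced-down : ∀ x y → Admissible (forcedH (suc x) (suc y)) (forcedD (suc x) y) (forcedG (suc x) y)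
  forced-down x y = subst₂ (λ h d → Admissible h d (forcedG (suc x) y)) (sym horizontal-insert) (sym diagonal-insert)
                      (down-admissible (β (suc x)) (sorted x y))
    where
    horizontal-insert : horizontal (β (suc x)) (sorted (suc x) (suc y)) ≡ horizontal (β (suc x)) (sorted x y)
    horizontal-insert with β (suc x)
    ... | F0 = refl
    ... | F1 = horizontal₁-insert (tally β F2 (suc x)) (tally β F1 (suc x)) y
    ... | F2 = refl
    diagonal-insert : diagonal (β (suc x)) (sorted (suc x) y) ≡ diagonal (β (suc x)) (sorted x y)
    diagonal-insert with β (suc x)
    ... | F0 = refl
    ... | F1 = diagonal₁-insert (tally β F2 (suc x)) (tally β F1 (suc x)) y
    ... | F2 = refl

  forced-bottom : ∀ x → forcedH x 0 ≡ label (β x)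
  forced-bottom x with β x
  ... | F0 = refl
  ... | F1 = horizontal₁-head (tally β F2 x) (tally β F1 x)
  ... | F2 = refl

  forced-diagonal : ∀ x → forcedD x x ≡ label (β x)
  forced-diagonal x with β x | tally-total β (suc x)
  ... | F0 | total = cong (diagonal F0) (sortedWord-0 (tally β F2 x) (tally β F1 x) x (≤-from-+-suc _ (tally β F0 x) x total))
  ... | F1 | total = trans (cong (diagonal F1) (sortedWord-drop (tally β F2 x) (suc (tally β F1 x)) x twos≤x))
                            (diagonal₁-without-2 (suc (tally β F1 x)) (x ∸ tally β F2 x))
    where
    twos≤x : tally β F2 x ≤ x
    twos≤x = ≤-from-+-suc _ (tally β F1 x + tally β F0 x) x (trans (sym (+-assoc (tally β F2 x) _ _)) total)
  ... | F2 | total = refl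

module SortingTriangleUnique (β : ℕ → Fin 3) (n : ℕ) (hr gr dr : Reading)
  (up     : ∀ x y → y ≤ x → x < n → Admissible (dr x y) (gr (suc x) y) (hr x y))
  (down   : ∀ x y → y < x → x < n → Admissible (hr x (suc y)) (dr x y) (gr x y))
  (right  : ∀ y → y < n → gr n y ≡ label (SortingTriangle.sorted β (n ∸ 1) y))
  (bottom : ∀ x → x < n → hr x 0 ≡ label (β x)) where

  open SortingTriangle β

  RightEdgesForced : ℕ → Set
  RightEdgesForced x = ∀ y → y ≤ x → gr (suc x) y ≡ forcedG (suc x) y

  diagonal-step : ∀ x → x < n → RightEdgesForced x → ∀ y → y ≤ x → hr x y ≡ forcedH x y → dr x y ≡ forcedD x y
  diagonal-step x x<n R y y≤x hr≡ =
    admissible-injective₁ (subst-admissible refl (R y y≤x) hr≡ (up x y y≤x x<n)) (forced-up x y)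

  -- The horizontal edge above a cell is fixed first by horizontal-forced; the diagonal and the left
  -- edge of the cell then follow by injectivity of the tiles.
  cell-step : ∀ x → x < n → RightEdgesForced x → ∀ y → y < x → hr x y ≡ forcedH x y →
              hr x (suc y) ≡ forcedH x (suc y) × gr x y ≡ forcedG x y
  cell-step (suc x) x<n R y (s≤s y≤x) hr≡ =
    hr'≡ , admissible-injective₃ (subst-admissible hr'≡ refl refl down') (forced-down x y)
    where
    down' : Admissible (hr (suc x) (suc y)) (forcedD (suc x) y) (gr (suc x) y)
    down' = subst-admissible refl (diagonal-step (suc x) x<n R y (m≤n⇒m≤1+n y≤x) hr≡) refl
              (down (suc x) y (s≤s y≤x) x<n)
    up' : Admissible (dr (suc x) (suc y)) (forcedG (suc (suc x)) (suc y)) (hr (suc x) (suc y))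
    up' = subst-admissible refl (R (suc y) (s≤s y≤x)) refl (up (suc x) (suc y) (s≤s y≤x) x<n)
    hr'≡ : hr (suc x) (suc y) ≡ forcedH (suc x) (suc y)
    hr'≡ = horizontal-forced {c = β (suc x)} (sorted-antitone (suc x) y) (forced-down x y) down' up'

  column-forced : ∀ x → x < n → RightEdgesForced x → ∀ y → y ≤ x → hr x y ≡ forcedH x y
  column-forced x x<n R zero    _   = trans (bottom x x<n) (sym (forced-bottom x))
  column-forced x x<n R (suc y) y<x = proj₁ (cell-step x x<n R y y<x (column-forced x x<n R y (<⇒≤ y<x)))

  leftEdges-forced : ∀ x → x < n → RightEdgesForced x → ∀ y → y < x → gr x y ≡ forcedG x y
  leftEdges-forced x x<n R y y<x = proj₂ (cell-step x x<n R y y<x (column-forced x x<n R y (<⇒≤ y<x)))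

  rightEdgesForced-from : ∀ k x → k + suc x ≡ n → RightEdgesForced x
  rightEdgesForced-from zero    x eq y y≤x =
    subst (λ m → gr m y ≡ label (sorted (m ∸ 1) y)) (sym eq) (right y (subst (y <_) eq (s≤s y≤x)))
  rightEdgesForced-from (suc k) x eq y y≤x =
    leftEdges-forced (suc x) (subst (suc x <_) eq' (m≤n+m (suc (suc x)) k)) (rightEdgesForced-from k (suc x) eq') y (s≤s y≤x)
    where
    eq' : k + suc (suc x) ≡ n
    eq' = trans (+-suc k (suc x)) eq

  rightEdgesForced : ∀ x → x < n → RightEdgesForced x
  rightEdgesForced x x<n = rightEdgesForced-from (n ∸ suc x) x (m∸n+n≡m x<n)

  hr-forced : ∀ x y → y ≤ x → x < n → hr x y ≡ forcedH x y
  hr-forced x y y≤x x<n = column-forced x x<n (rightEdgesForced x x<n) y y≤x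

  dr-forced : ∀ x y → y ≤ x → x < n → dr x y ≡ forcedD x y
  dr-forced x y y≤x x<n = diagonal-step x x<n (rightEdgesForced x x<n) y y≤x (hr-forced x y y≤x x<n)

  gr-forced : ∀ x y → y < x → x ≤ n → gr x y ≡ forcedG x y
  gr-forced x y y<x x≤n with m≤n⇒m<n∨m≡n x≤n
  ... | inj₁ x<n  = leftEdges-forced x x<n (rightEdgesForced x x<n) y y<x
  ... | inj₂ refl = right y y<x


_≗₂_ : Reading → Reading → Set
f ≗₂ g = ∀ x y → f x y ≡ g x y

get-toℕ : ∀ {m k} (g : Grid m k) i j → get g (toℕ i) (toℕ j) ≡ g i j
get-toℕ {m} {k} g i j with toℕ i <? m | toℕ j <? k
... | yes p | yes q = cong₂ g (fromℕ<-toℕ i p) (fromℕ<-toℕ j q)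
... | yes _ | no ¬q = ⊥-elim (¬q (toℕ<n j))
... | no ¬p | _     = ⊥-elim (¬p (toℕ<n i))

get-cong : ∀ {m k} {g g' : Grid m k} → (∀ i j → g i j ≡ g' i j) → get g ≗₂ get g'
get-cong {m} {k} g≗g' x y with x <? m | y <? k
... | yes _ | yes _ = g≗g' _ _
... | yes _ | no  _ = refl
... | no  _ | _     = refl

tabulate₂ : ∀ {m k} → Reading → Grid m k
tabulate₂ f i j = f (toℕ i) (toℕ j)

get-tabulate₂ : ∀ {m k} f x y → x < m → y < k → get {m} {k} (tabulate₂ f) x y ≡ f x y
get-tabulate₂ {m} {k} f x y x<m y<k with x <? m | y <? k
... | yes p | yes q = cong₂ f (toℕ-fromℕ< p) (toℕ-fromℕ< q)
... | yes _ | no ¬q = ⊥-elim (¬q y<k)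
... | no ¬p | _     = ⊥-elim (¬p x<m)

tabulate₂-cong : ∀ {m k} {f f' : Reading} → f ≗₂ f' → get {m} {k} (tabulate₂ f) ≗₂ get {m} {k} (tabulate₂ f')
tabulate₂-cong {m} {k} {f} {f'} f≗f' = get-cong {m} {k} {tabulate₂ f} {tabulate₂ f'} λ i j → f≗f' (toℕ i) (toℕ j)

get-outside : ∀ {m k} (g : Grid m k) x y → m ≤ x ⊎ k ≤ y → get g x y ≡ zero
get-outside {m} {k} g x y out with x <? m | y <? k
... | yes x<m | yes y<k = ⊥-elim ([ <⇒≱ x<m , <⇒≱ y<k ]′ out)
... | yes _   | no _    = refl
... | no _    | _       = refl

get-≗₂ : ∀ {m k} (g g' : Grid m k) → (∀ x y → x < m → y < k → get g x y ≡ get g' x y) → get g ≗₂ get g'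
get-≗₂ {m} {k} g g' inside x y = by-cases (x <? m) (y <? k)
  where
  both-zero : m ≤ x ⊎ k ≤ y → get g x y ≡ get g' x y
  both-zero out = trans (get-outside g x y out) (sym (get-outside g' x y out))
  by-cases : Dec (x < m) → Dec (y < k) → get g x y ≡ get g' x y
  by-cases (yes x<m) (yes y<k) = inside x y x<m y<k
  by-cases (yes _)   (no y≮k)  = both-zero (inj₂ (≮⇒≥ y≮k))
  by-cases (no x≮m)  _         = both-zero (inj₁ (≮⇒≥ x≮m))

module _ {n} (τ : TriLabeling n) where
  triH triD triA : Reading
  triH = get (TriLabeling.H τ)
  triD = get (TriLabeling.D τ)
  triA = get (TriLabeling.A τ)

module _ {n} (X : RhLabeling n) where
  rhH rhG rhD : Reading
  rhH = get (RhLabeling.Hr X)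
  rhG = get (RhLabeling.Gr X)
  rhD = get (RhLabeling.Dr X)

Readings : Set
Readings = Reading × Reading × Reading

_≃_ : Readings → Readings → Set
(f , g , h) ≃ (f' , g' , h') = f ≗₂ f' × g ≗₂ g' × h ≗₂ h'

≃-sym : ∀ {ρ ρ'} → ρ ≃ ρ' → ρ' ≃ ρ
≃-sym (f , g , h) = (λ x y → sym (f x y)) , (λ x y → sym (g x y)) , (λ x y → sym (h x y))

≃-trans : ∀ {ρ ρ' ρ''} → ρ ≃ ρ' → ρ' ≃ ρ'' → ρ ≃ ρ''
≃-trans (f , g , h) (f' , g' , h') =
  (λ x y → trans (f x y) (f' x y)) , (λ x y → trans (g x y) (g' x y)) , (λ x y → trans (h x y) (h' x y))

triReadings : ∀ {n} → TriLabeling n → Readings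
triReadings τ = triH τ , triD τ , triA τ

rhReadings : ∀ {n} → RhLabeling n → Readings
rhReadings X = rhH X , rhG X , rhD X

∧-split : ∀ {a b} → T (a ∧ b) → T a × T b
∧-split = Equivalence.to T-∧

∧-intro : ∀ {a b} → T a → T b → T (a ∧ b)
∧-intro p q = Equivalence.from T-∧ (p , q)

==⇒≡ : ∀ {x y} → T (x == y) → x ≡ y
==⇒≡ {x} {y} p with x Fin.≟ y
... | yes x≡y = x≡y

≡⇒== : ∀ {x y} → x ≡ y → T (x == y)
≡⇒== {x} {y} x≡y = subst T (sym (dec-true (x Fin.≟ y) x≡y)) tt

≤ᵇ-true : ∀ {m n} → m ≤ n → (m ≤ᵇ n) ≡ true
≤ᵇ-true = dec-true (_ ≤? _)

≤ᵇ-false : ∀ {m n} → n < m → (m ≤ᵇ n) ≡ false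
≤ᵇ-false n<m = dec-false (_ ≤? _) (<⇒≱ n<m)

allBelow⁻ : ∀ {n} {p : ℕ → Bool} → T (allBelow n p) → ∀ k → k < n → T (p k)
allBelow⁻ {n} {p} all k k<n = applyUpTo⁻ id n (all⁺ p (upTo n) all) k<n

allBelow⁺ : ∀ {n} {p : ℕ → Bool} → (∀ k → k < n → T (p k)) → T (allBelow n p)
allBelow⁺ {n} {p} h = all⁻ p (applyUpTo⁺₁ id n (λ {k} → h k))

allBelow²⁻ : ∀ {n} {p : ℕ → ℕ → Bool} → T (allBelow n λ i → allBelow n (p i)) →
             ∀ i j → i < n → j < n → T (p i j)
allBelow²⁻ {p = p} all i j i<n j<n = allBelow⁻ {p = p i} (allBelow⁻ all i i<n) j j<n

allBelow²⁺ : ∀ {n} {p : ℕ → ℕ → Bool} → (∀ i j → i < n → j < n → T (p i j)) →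
             T (allBelow n λ i → allBelow n (p i))
allBelow²⁺ h = allBelow⁺ λ i i<n → allBelow⁺ λ j j<n → h i j i<n j<n

if-true : ∀ {A : Set} {b} {x y : A} → b ≡ true → (if b then x else y) ≡ x
if-true refl = refl

if-false : ∀ {A : Set} {b} {x y : A} → b ≡ false → (if b then x else y) ≡ y
if-false refl = refl

<ᵇ-true : ∀ {m n} → m < n → (m <ᵇ n) ≡ true
<ᵇ-true = dec-true (_ <? _)

<ᵇ-false : ∀ {m n} → n ≤ m → (m <ᵇ n) ≡ false
<ᵇ-false n≤m = dec-false (_ <? _) (≤⇒≯ n≤m)

record TriPuzzle {n} (u v w : Vec (Fin 3) n) (H D A : Reading) : Set where
  field
    up      : ∀ i j → i + j < n → Admissible (D i j) (A i j) (H i j)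
    down    : ∀ i j → suc (suc (i + j)) ≤ n → Admissible (H i (suc j)) (D (suc i) j) (A i j)
    outside : ∀ i j → i < n → j < n → n ≤ i + j → H i j ≡ zero × D i j ≡ zero × A i j ≡ zero
    left    : ∀ k → k < n → D 0 k ≡ str u k
    right   : ∀ k → k < n → A k (n ∸ suc k) ≡ str v k
    bottom  : ∀ k → k < n → H k 0 ≡ str w k

record RhPuzzle {n} (t r b l : Vec (Fin 3) n) (H G D : Reading) : Set where
  field
    up     : ∀ x y → x < n → y < n → Admissible (D x y) (G (suc x) y) (H x y)
    down   : ∀ x y → x < n → y < n → Admissible (H x (suc y)) (D x y) (G x y)
    top    : ∀ k → k < n → H k n ≡ str t k
    right  : ∀ k → k < n → G n (n ∸ suc k) ≡ str r k
    bottom : ∀ k → k < n → H (n ∸ suc k) 0 ≡ str b k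
    left   : ∀ k → k < n → G 0 (n ∸ suc k) ≡ str l k

+<⇒ˡ< : ∀ {i j n} → i + j < n → i < n
+<⇒ˡ< {i} {j} p = ≤-<-trans (m≤m+n i j) p

+<⇒ʳ< : ∀ {i j n} → i + j < n → j < n
+<⇒ʳ< {i} {j} p = ≤-<-trans (m≤n+m j i) p

module _ {n} {u v w : Vec (Fin 3) n} {τ : TriLabeling n} where

  isTriPuzzle⇒TriPuzzle : T (isTriPuzzle u v w τ) → TriPuzzle u v w (triH τ) (triD τ) (triA τ)
  isTriPuzzle⇒TriPuzzle p with ∧-split {allBelow n _} p
  ... | upCells , rest with ∧-split {allBelow n _} rest
  ... | downCells , sideCells = record
    { up      = λ i j i+j<n → admissible (subst T (if-false (≤ᵇ-false i+j<n)) (up-cell i j (+<⇒ˡ< i+j<n) (+<⇒ʳ< i+j<n)))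
    ; down    = λ i j 2+i+j≤n → admissible (subst T (if-true (≤ᵇ-true 2+i+j≤n))
                  (down-cell i j (+<⇒ˡ< {j = suc j} (subst (_≤ n) (cong suc (sym (+-suc i j))) 2+i+j≤n))
                                 (+<⇒ʳ< (<-trans (n<1+n _) 2+i+j≤n))))
    ; outside = λ i j i<n j<n n≤i+j → outside i j (subst T (if-true (≤ᵇ-true n≤i+j)) (up-cell i j i<n j<n))
    ; left    = λ k k<n → proj₁ (sides k k<n)
    ; right   = λ k k<n → proj₁ (proj₂ (sides k k<n))
    ; bottom  = λ k k<n → proj₂ (proj₂ (sides k k<n))
    }
    where
    ==³⇒≡³ : ∀ x x' y y' z z' → T ((x == x') ∧ (y == y') ∧ (z == z')) → x ≡ x' × y ≡ y' × z ≡ z'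
    ==³⇒≡³ x x' y y' z z' eqs = let (x= , yz=) = ∧-split {x == x'} eqs; (y= , z=) = ∧-split {y == y'} yz= in
      ==⇒≡ x= , ==⇒≡ y= , ==⇒≡ z=
    outside : ∀ i j → T ((triH τ i j == zero) ∧ (triD τ i j == zero) ∧ (triA τ i j == zero)) →
              triH τ i j ≡ zero × triD τ i j ≡ zero × triA τ i j ≡ zero
    outside i j = ==³⇒≡³ _ _ _ _ _ _
    up-cell : ∀ i j → i < n → j < n → T (if n ≤ᵇ i + j
      then (triH τ i j == zero) ∧ (triD τ i j == zero) ∧ (triA τ i j == zero)
      else allowed (triD τ i j) (triA τ i j) (triH τ i j))
    up-cell = allBelow²⁻ upCells
    down-cell : ∀ i j → i < n → j < n →
      T (if suc (suc (i + j)) ≤ᵇ n then allowed (triH τ i (suc j)) (triD τ (suc i) j) (triA τ i j) else true)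
    down-cell = allBelow²⁻ downCells
    sides : ∀ k → k < n → triD τ 0 k ≡ str u k × triA τ k (n ∸ suc k) ≡ str v k × triH τ k 0 ≡ str w k
    sides k k<n = ==³⇒≡³ _ _ _ _ _ _ (allBelow⁻ sideCells k k<n)

  TriPuzzle⇒isTriPuzzle : TriPuzzle u v w (triH τ) (triD τ) (triA τ) → T (isTriPuzzle u v w τ)
  TriPuzzle⇒isTriPuzzle P =
    ∧-intro (allBelow²⁺ upCell) (∧-intro (allBelow²⁺ {n} λ i j _ _ → downCell i j) (allBelow⁺ side))
    where
    open TriPuzzle P
    upCell : ∀ i j → i < n → j < n → T (if n ≤ᵇ i + j
      then (triH τ i j == zero) ∧ (triD τ i j == zero) ∧ (triA τ i j == zero)
      else allowed (triD τ i j) (triA τ i j) (triH τ i j))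
    upCell i j i<n j<n with i + j <? n
    ... | yes i+j<n = subst T (sym (if-false (≤ᵇ-false i+j<n))) (Admissible.isAllowed (up i j i+j<n))
    ... | no  i+j≮n = subst T (sym (if-true (≤ᵇ-true (≮⇒≥ i+j≮n))))
                        (let (h , d , a) = outside i j i<n j<n (≮⇒≥ i+j≮n) in
                         ∧-intro (≡⇒== h) (∧-intro (≡⇒== d) (≡⇒== a)))
    downCell : ∀ i j →
      T (if suc (suc (i + j)) ≤ᵇ n then allowed (triH τ i (suc j)) (triD τ (suc i) j) (triA τ i j) else true)
    downCell i j with suc (suc (i + j)) ≤? n
    ... | yes fits = subst T (sym (if-true (≤ᵇ-true fits))) (Admissible.isAllowed (down i j fits))
    ... | no  ¬fits = subst T (sym (if-false (≤ᵇ-false (≰⇒> ¬fits)))) tt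
    side : ∀ k → k < n → T ((triD τ 0 k == str u k) ∧ (triA τ k (n ∸ suc k) == str v k) ∧ (triH τ k 0 == str w k))
    side k k<n = ∧-intro (≡⇒== (left k k<n)) (∧-intro (≡⇒== (right k k<n)) (≡⇒== (bottom k k<n)))

module _ {n} {t r b l : Vec (Fin 3) n} {X : RhLabeling n} where

  isRhPuzzle⇒RhPuzzle : T (isRhPuzzle t r b l X) → RhPuzzle t r b l (rhH X) (rhG X) (rhD X)
  isRhPuzzle⇒RhPuzzle p with ∧-split {allBelow n _} p
  ... | cellPairs , sideCells = record
    { up     = λ x y x<n y<n → proj₁ (cells x y x<n y<n)
    ; down   = λ x y x<n y<n → proj₂ (cells x y x<n y<n)
    ; top    = λ k k<n → ==⇒≡ (proj₁ (sides k k<n))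
    ; right  = λ k k<n → ==⇒≡ (proj₁ (proj₂ (sides k k<n)))
    ; bottom = λ k k<n → ==⇒≡ (proj₁ (proj₂ (proj₂ (sides k k<n))))
    ; left   = λ k k<n → ==⇒≡ (proj₂ (proj₂ (proj₂ (sides k k<n))))
    }
    where
    cells : ∀ x y → x < n → y < n →
      Admissible (rhD X x y) (rhG X (suc x) y) (rhH X x y) × Admissible (rhH X x (suc y)) (rhD X x y) (rhG X x y)
    cells x y x<n y<n = let (up , down) = ∧-split {allowed (rhD X x y) (rhG X (suc x) y) (rhH X x y)}
                                            (allBelow²⁻ cellPairs x y x<n y<n)
                        in admissible up , admissible down
    sides : ∀ k → k < n → T (rhH X k n == str t k) × T (rhG X n (n ∸ suc k) == str r k) ×
                          T (rhH X (n ∸ suc k) 0 == str b k) × T (rhG X 0 (n ∸ suc k) == str l k)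
    sides k k<n = let (t= , rbl=) = ∧-split {rhH X k n == str t k} (allBelow⁻ sideCells k k<n)
                      (r= , bl=) = ∧-split {rhG X n (n ∸ suc k) == str r k} rbl=
                  in t= , r= , ∧-split {rhH X (n ∸ suc k) 0 == str b k} bl=

  RhPuzzle⇒isRhPuzzle : RhPuzzle t r b l (rhH X) (rhG X) (rhD X) → T (isRhPuzzle t r b l X)
  RhPuzzle⇒isRhPuzzle P = ∧-intro
    (allBelow²⁺ λ x y x<n y<n → ∧-intro (Admissible.isAllowed (up x y x<n y<n)) (Admissible.isAllowed (down x y x<n y<n)))
    (allBelow⁺ λ k k<n → ∧-intro (≡⇒== (top k k<n)) (∧-intro (≡⇒== (right k k<n))
                           (∧-intro (≡⇒== (bottom k k<n)) (≡⇒== (left k k<n)))))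
    where open RhPuzzle P

TriPuzzle-transport : ∀ {n} {u v w : Vec (Fin 3) n} {H D A H' D' A'} → (H , D , A) ≃ (H' , D' , A') →
  TriPuzzle u v w H D A → TriPuzzle u v w H' D' A'
TriPuzzle-transport (H= , D= , A=) P = record
  { up      = λ i j p → subst-admissible (D= i j) (A= i j) (H= i j) (up i j p)
  ; down    = λ i j p → subst-admissible (H= i (suc j)) (D= (suc i) j) (A= i j) (down i j p)
  ; outside = λ i j p q r → let (h , d , a) = outside i j p q r in
                trans (sym (H= i j)) h , trans (sym (D= i j)) d , trans (sym (A= i j)) a
  ; left    = λ k p → trans (sym (D= 0 k)) (left k p)
  ; right   = λ k p → trans (sym (A= k _)) (right k p)
  ; bottom  = λ k p → trans (sym (H= k 0)) (bottom k p)
  }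
  where open TriPuzzle P

RhPuzzle-transport : ∀ {n} {t r b l : Vec (Fin 3) n} {H G D H' G' D'} → (H , G , D) ≃ (H' , G' , D') →
  RhPuzzle t r b l H G D → RhPuzzle t r b l H' G' D'
RhPuzzle-transport (H= , G= , D=) P = record
  { up     = λ x y p q → subst-admissible (D= x y) (G= (suc x) y) (H= x y) (up x y p q)
  ; down   = λ x y p q → subst-admissible (H= x (suc y)) (D= x y) (G= x y) (down x y p q)
  ; top    = λ k p → trans (sym (H= k _)) (top k p)
  ; right  = λ k p → trans (sym (G= _ _)) (right k p)
  ; bottom = λ k p → trans (sym (H= _ 0)) (bottom k p)
  ; left   = λ k p → trans (sym (G= 0 _)) (left k p)
  }
  where open RhPuzzle P

-- Counting

module _ {A : Set} where

  ∑ : List A → (A → ℕ) → ℕ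
  ∑ []       f = 0
  ∑ (x ∷ xs) f = f x + ∑ xs f

  count : (A → Bool) → List A → ℕ
  count p xs = ∑ xs (λ a → 𝟙 (p a))

  length-filterᵇ : ∀ p xs → length (filterᵇ p xs) ≡ count p xs
  length-filterᵇ p [] = refl
  length-filterᵇ p (x ∷ xs) with p x
  ... | true  = cong suc (length-filterᵇ p xs)
  ... | false = length-filterᵇ p xs

  ∑-cong : ∀ xs {f g : A → ℕ} → (∀ a → f a ≡ g a) → ∑ xs f ≡ ∑ xs g
  ∑-cong []       f≗g = refl
  ∑-cong (x ∷ xs) f≗g = cong₂ _+_ (f≗g x) (∑-cong xs f≗g)

  ∑-+ : ∀ xs (f g : A → ℕ) → ∑ xs (λ a → f a + g a) ≡ ∑ xs f + ∑ xs g
  ∑-+ []       f g = refl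
  ∑-+ (x ∷ xs) f g = trans (cong (f x + g x +_) (∑-+ xs f g)) (+-interchange (f x) (g x) (∑ xs f) (∑ xs g))

  ∑-zero : ∀ xs → ∑ xs (λ _ → 0) ≡ 0
  ∑-zero []       = refl
  ∑-zero (_ ∷ xs) = ∑-zero xs

  ∑-*ˡ : ∀ xs c (f : A → ℕ) → ∑ xs (λ a → c * f a) ≡ c * ∑ xs f
  ∑-*ˡ []       c f = sym (*-zeroʳ c)
  ∑-*ˡ (x ∷ xs) c f = trans (cong (c * f x +_) (∑-*ˡ xs c f)) (sym (*-distribˡ-+ c (f x) (∑ xs f)))

  ∑-++ : ∀ xs ys (f : A → ℕ) → ∑ (xs ++ ys) f ≡ ∑ xs f + ∑ ys f
  ∑-++ []       ys f = refl
  ∑-++ (x ∷ xs) ys f = trans (cong (f x +_) (∑-++ xs ys f)) (sym (+-assoc (f x) (∑ xs f) (∑ ys f)))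

module _ {A B : Set} where

  ∑-swap : ∀ (xs : List A) (ys : List B) (f : A → B → ℕ) →
           ∑ xs (λ a → ∑ ys (f a)) ≡ ∑ ys (λ b → ∑ xs (λ a → f a b))
  ∑-swap []       ys f = sym (∑-zero ys)
  ∑-swap (x ∷ xs) ys f =
    trans (cong (∑ ys (f x) +_) (∑-swap xs ys f)) (sym (∑-+ ys (f x) (λ b → ∑ xs (λ a → f a b))))

  ∑-map : ∀ (h : A → B) xs (f : B → ℕ) → ∑ (map h xs) f ≡ ∑ xs (λ a → f (h a))
  ∑-map h []       f = refl
  ∑-map h (x ∷ xs) f = cong (f (h x) +_) (∑-map h xs f)

  ∑-concatMap : ∀ (h : A → List B) xs (f : B → ℕ) → ∑ (concatMap h xs) f ≡ ∑ xs (λ a → ∑ (h a) f)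
  ∑-concatMap h []       f = refl
  ∑-concatMap h (x ∷ xs) f = trans (∑-++ (h x) (concatMap h xs) f) (cong (∑ (h x) f +_) (∑-concatMap h xs f))

  double-counting : ∀ (xs : List A) (ys : List B) (P : A → Bool) (Q : B → Bool) (R : A → B → Bool) →
    (∀ a → count (R a) ys ≡ 𝟙 (P a)) → (∀ b → count (λ a → R a b) xs ≡ 𝟙 (Q b)) → count P xs ≡ count Q ys
  double-counting xs ys P Q R row-sums column-sums = begin
    ∑ xs (λ a → 𝟙 (P a))                ≡⟨ ∑-cong xs (λ a → sym (row-sums a)) ⟩
    ∑ xs (λ a → ∑ ys (λ b → 𝟙 (R a b))) ≡⟨ ∑-swap xs ys (λ a b → 𝟙 (R a b)) ⟩
    ∑ ys (λ b → ∑ xs (λ a → 𝟙 (R a b))) ≡⟨ ∑-cong ys column-sums ⟩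
    ∑ ys (λ b → 𝟙 (Q b))                ∎
    where open ≡-Reasoning

count-∧-once : ∀ {A : Set} (xs : List A) p (q : A → Bool) → count q xs ≡ 1 → count (λ a → p ∧ q a) xs ≡ 𝟙 p
count-∧-once xs p q once = begin
  ∑ xs (λ a → 𝟙 (p ∧ q a))   ≡⟨ ∑-cong xs (λ a → 𝟙-∧ p (q a)) ⟩
  ∑ xs (λ a → 𝟙 p * 𝟙 (q a)) ≡⟨ ∑-*ˡ xs (𝟙 p) (λ a → 𝟙 (q a)) ⟩
  𝟙 p * count q xs           ≡⟨ cong (𝟙 p *_) once ⟩
  𝟙 p * 1                    ≡⟨ *-identityʳ (𝟙 p) ⟩
  𝟙 p                        ∎
  where open ≡-Reasoning

pointwise : ∀ {X : Set} n → (X → X → Bool) → (Fin n → X) → (Fin n → X) → Bool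
pointwise zero    _≈_ f g = true
pointwise (suc n) _≈_ f g = (f zero ≈ g zero) ∧ pointwise n _≈_ (λ i → f (suc i)) (λ i → g (suc i))

pointwise⁻ : ∀ {X : Set} n (_≈_ : X → X → Bool) f g → T (pointwise n _≈_ f g) → ∀ i → T (f i ≈ g i)
pointwise⁻ (suc n) _≈_ f g p zero    = proj₁ (∧-split {f zero ≈ g zero} p)
pointwise⁻ (suc n) _≈_ f g p (suc i) = pointwise⁻ n _≈_ _ _ (proj₂ (∧-split {f zero ≈ g zero} p)) i

pointwise⁺ : ∀ {X : Set} n (_≈_ : X → X → Bool) f g → (∀ i → T (f i ≈ g i)) → T (pointwise n _≈_ f g)
pointwise⁺ zero    _≈_ f g p = _
pointwise⁺ (suc n) _≈_ f g p = ∧-intro (p zero) (pointwise⁺ n _≈_ _ _ (λ i → p (suc i)))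

allPi-once : ∀ {X : Set} n (_≈_ : X → X → Bool) (xs : Fin n → List X) →
  (∀ i x → count (_≈ x) (xs i) ≡ 1) → ∀ f → count (λ g → pointwise n _≈_ g f) (allPi xs) ≡ 1
allPi-once zero    _≈_ xs once f = refl
allPi-once {X} (suc n) _≈_ xs once f = begin
  count (λ g → pointwise (suc n) _≈_ g f) (allPi xs)
    ≡⟨ ∑-concatMap _ (xs zero) _ ⟩
  ∑ (xs zero) (λ x → ∑ (map _ tails) _)
    ≡⟨ ∑-cong (xs zero) (λ x → ∑-map _ tails _) ⟩
  ∑ (xs zero) (λ x → count (λ g → (x ≈ f zero) ∧ pointwise n _≈_ g (λ i → f (suc i))) tails)
    ≡⟨ ∑-cong (xs zero) (λ x → count-∧-once tails (x ≈ f zero) _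
                                  (allPi-once n _≈_ (λ i → xs (suc i)) (λ i → once (suc i)) _)) ⟩
  count (_≈ f zero) (xs zero)
    ≡⟨ once zero (f zero) ⟩
  1 ∎
  where
  open ≡-Reasoning
  tails : List ((i : Fin n) → X)
  tails = allPi (λ i → xs (suc i))

product³-once : ∀ {X Y Z W : Set} (xs : List X) (ys : List Y) (zs : List Z) (mk : X → Y → Z → W) (p : W → Bool)
  (px : X → Bool) (py : Y → Bool) (pz : Z → Bool) → (∀ x y z → p (mk x y z) ≡ (px x ∧ py y) ∧ pz z) →
  count px xs ≡ 1 → count py ys ≡ 1 → count pz zs ≡ 1 →
  count p (concatMap (λ x → concatMap (λ y → map (mk x y) zs) ys) xs) ≡ 1
product³-once xs ys zs mk p px py pz split onceX onceY onceZ = begin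
  count p (concatMap (λ x → concatMap (λ y → map (mk x y) zs) ys) xs)
    ≡⟨ ∑-concatMap _ xs _ ⟩
  ∑ xs (λ x → ∑ (concatMap (λ y → map (mk x y) zs) ys) (λ w → 𝟙 (p w)))
    ≡⟨ ∑-cong xs (λ x → trans (∑-concatMap _ ys _) (∑-cong ys (λ y → ∑-map _ zs _))) ⟩
  ∑ xs (λ x → ∑ ys (λ y → ∑ zs (λ z → 𝟙 (p (mk x y z)))))
    ≡⟨ ∑-cong xs (λ x → ∑-cong ys (λ y →
         trans (∑-cong zs (λ z → cong 𝟙 (split x y z))) (count-∧-once zs _ pz onceZ))) ⟩
  ∑ xs (λ x → count (λ y → px x ∧ py y) ys)
    ≡⟨ ∑-cong xs (λ x → count-∧-once ys (px x) py onceY) ⟩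
  count px xs
    ≡⟨ onceX ⟩
  1 ∎
  where open ≡-Reasoning

_≈G_ : ∀ {m k} → Grid m k → Grid m k → Bool
_≈G_ {m} {k} g g' = pointwise m (pointwise k _==_) g g'

≈G⇒≗₂ : ∀ {m k} (g g' : Grid m k) → T (g ≈G g') → get g ≗₂ get g'
≈G⇒≗₂ {m} {k} g g' g≈g' = get-cong λ i j → ==⇒≡ (pointwise⁻ k _==_ _ _ (pointwise⁻ m _ g g' g≈g' i) j)

≗₂⇒≈G : ∀ {m k} (g g' : Grid m k) → get g ≗₂ get g' → T (g ≈G g')
≗₂⇒≈G {m} {k} g g' g≗g' = pointwise⁺ m _ g g' λ i → pointwise⁺ k _==_ _ _ λ j →
  ≡⇒== (trans (sym (get-toℕ g i j)) (trans (g≗g' _ _) (get-toℕ g' i j)))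

allFin-once : ∀ (x : Label) → count (_== x) (allFin 8) ≡ 1
allFin-once = toWitness {a? = all? λ x → count (_== x) (allFin 8) ≟ 1} tt

allGrids-once : ∀ m k (g : Grid m k) → count (_≈G g) (allGrids m k) ≡ 1
allGrids-once m k = allPi-once m (pointwise k _==_) _ λ _ → allPi-once k _==_ _ λ _ → allFin-once

_≈T_ : ∀ {n} → TriLabeling n → TriLabeling n → Bool
triLab H D A ≈T triLab H' D' A' = (H ≈G H' ∧ D ≈G D') ∧ A ≈G A'

_≈R_ : ∀ {n} → RhLabeling n → RhLabeling n → Bool
rhLab H G D ≈R rhLab H' G' D' = (H ≈G H' ∧ G ≈G G') ∧ D ≈G D'

≈T⇒≃ : ∀ {n} (τ τ' : TriLabeling n) → T (τ ≈T τ') → triReadings τ ≃ triReadings τ'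
≈T⇒≃ (triLab H D A) (triLab H' D' A') eq =
  let (HD= , A=) = ∧-split {H ≈G H' ∧ D ≈G D'} eq ; (H= , D=) = ∧-split {H ≈G H'} HD=
  in ≈G⇒≗₂ H H' H= , ≈G⇒≗₂ D D' D= , ≈G⇒≗₂ A A' A=

≃⇒≈T : ∀ {n} (τ τ' : TriLabeling n) → triReadings τ ≃ triReadings τ' → T (τ ≈T τ')
≃⇒≈T (triLab H D A) (triLab H' D' A') (H= , D= , A=) =
  ∧-intro (∧-intro (≗₂⇒≈G H H' H=) (≗₂⇒≈G D D' D=)) (≗₂⇒≈G A A' A=)

≈R⇒≃ : ∀ {n} (X X' : RhLabeling n) → T (X ≈R X') → rhReadings X ≃ rhReadings X'
≈R⇒≃ (rhLab H G D) (rhLab H' G' D') eq =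
  let (HG= , D=) = ∧-split {H ≈G H' ∧ G ≈G G'} eq ; (H= , G=) = ∧-split {H ≈G H'} HG=
  in ≈G⇒≗₂ H H' H= , ≈G⇒≗₂ G G' G= , ≈G⇒≗₂ D D' D=

≃⇒≈R : ∀ {n} (X X' : RhLabeling n) → rhReadings X ≃ rhReadings X' → T (X ≈R X')
≃⇒≈R (rhLab H G D) (rhLab H' G' D') (H= , G= , D=) =
  ∧-intro (∧-intro (≗₂⇒≈G H H' H=) (≗₂⇒≈G G G' G=)) (≗₂⇒≈G D D' D=)

allTriLabelings-once : ∀ n (τ : TriLabeling n) → count (_≈T τ) (allTriLabelings n) ≡ 1
allTriLabelings-once n (triLab H D A) =
  product³-once (allGrids n n) (allGrids n n) (allGrids n n) triLab _ (_≈G H) (_≈G D) (_≈G A) (λ _ _ _ → refl)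
    (allGrids-once n n H) (allGrids-once n n D) (allGrids-once n n A)

allRhLabelings-once : ∀ n (X : RhLabeling n) → count (_≈R X) (allRhLabelings n) ≡ 1
allRhLabelings-once n (rhLab H G D) =
  product³-once (allGrids n (suc n)) (allGrids (suc n) n) (allGrids n n) rhLab _ (_≈G H) (_≈G G) (_≈G D) (λ _ _ _ → refl)
    (allGrids-once n (suc n) H) (allGrids-once (suc n) n G) (allGrids-once n n D)

Bool-ext : ∀ {a b} → (T a → T b) → (T b → T a) → a ≡ b
Bool-ext {false} {false} _ _ = refl
Bool-ext {false} {true}  _ g = ⊥-elim (g tt)
Bool-ext {true}  {false} f _ = ⊥-elim (f tt)
Bool-ext {true}  {true}  _ _ = refl

∸-suc : ∀ {x m} → x < m → m ∸ x ≡ suc (m ∸ suc x)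
∸-suc x<m = +-∸-assoc 1 x<m

∸-suc-< : ∀ {k n} → k < n → n ∸ suc k < n
∸-suc-< {k} {n} k<n = ∸-monoʳ-< {n} {suc k} {0} (s≤s z≤n) k<n

∸-suc-involutive : ∀ {y n} → y < n → n ∸ suc (n ∸ suc y) ≡ y
∸-suc-involutive {y} {n} y<n = trans (cong (n ∸_) (sym (∸-suc y<n))) (m∸[m∸n]≡n (<⇒≤ y<n))

∸-suc-+-< : ∀ {x y n} → x ≤ y → y < n → (n ∸ suc y) + x < n
∸-suc-+-< {x} {y} {n} x≤y y<n = begin-strict
  (n ∸ suc y) + x     ≤⟨ +-monoʳ-≤ (n ∸ suc y) x≤y ⟩
  (n ∸ suc y) + y     <⟨ +-monoʳ-< (n ∸ suc y) (n<1+n y) ⟩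
  (n ∸ suc y) + suc y ≡⟨ m∸n+n≡m y<n ⟩
  n                   ∎
  where open ≤-Reasoning

∸-+-< : ∀ {x y n} → x < y → y ≤ n → (n ∸ y) + x < n
∸-+-< {x} {y} {n} x<y y≤n = begin-strict
  (n ∸ y) + x <⟨ +-monoʳ-< (n ∸ y) x<y ⟩
  (n ∸ y) + y ≡⟨ m∸n+n≡m y≤n ⟩
  n           ∎
  where open ≤-Reasoning

+<⇒≤∸-suc : ∀ {i j n} → i + j < n → j ≤ n ∸ suc i
+<⇒≤∸-suc {i} {j} {n} i+j<n = m+n≤o⇒m≤o∸n j (subst (_≤ n) (trans (cong suc (+-comm i j)) (sym (+-suc j i))) i+j<n)

+<⇒<∸ : ∀ {i j n} → i + j < n → j < n ∸ i
+<⇒<∸ {i} {j} {n} i+j<n = m+n≤o⇒m≤o∸n (suc j) (subst (_≤ n) (cong suc (+-comm i j)) i+j<n)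

at : ∀ {n} → Vec (Fin 3) n → ℕ → Fin 3
at []      _       = F0
at (e ∷ s) zero    = e
at (e ∷ s) (suc k) = at s k

at-fromℕ< : ∀ {n} (s : Vec (Fin 3) n) k .(k<n : k < n) → lookup s (fromℕ< k<n) ≡ at s k
at-fromℕ< (e ∷ s) zero    _   = refl
at-fromℕ< (e ∷ s) (suc k) k<n = at-fromℕ< s k (s<s⁻¹ k<n)

at-outside : ∀ {n} (s : Vec (Fin 3) n) k → n ≤ k → at s k ≡ F0
at-outside []      k       _       = refl
at-outside (e ∷ s) (suc k) (s≤s p) = at-outside s k p

str-at : ∀ {n} (s : Vec (Fin 3) n) k → str s k ≡ label (at s k)
str-at {n} s k with k <? n
... | yes k<n = cong label (at-fromℕ< s k k<n)
... | no  k≮n = cong label (sym (at-outside s k (≮⇒≥ k≮n)))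

at-tabulate : ∀ n (g : ℕ → Fin 3) k → k < n → at (tabulate {n = n} (λ i → g (toℕ i))) k ≡ g k
at-tabulate (suc n) g zero    _       = refl
at-tabulate (suc n) g (suc k) (s≤s p) = at-tabulate n (λ m → g (suc m)) k p

fromRight : ∀ {n} → Vec (Fin 3) n → ℕ → Fin 3
fromRight {n} s x = at s (n ∸ suc x)

tally-cong : ∀ {β β'} c m → (∀ x → x < m → β x ≡ β' x) → tally β c m ≡ tally β' c m
tally-cong c zero    β≗β' = refl
tally-cong c (suc m) β≗β' =
  cong₂ (λ e t → 𝟙 (does (e Fin.≟ c)) + t) (β≗β' m (n<1+n m)) (tally-cong c m (λ x p → β≗β' x (m<n⇒m<1+n p)))

tally-fromRight : ∀ {n} (s : Vec (Fin 3) n) c → tally (fromRight s) c n ≡ countᵇ (λ e → does (e Fin.≟ c)) s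
tally-fromRight []            c = refl
tally-fromRight {suc n} (e ∷ s) c
  rewrite n∸n≡0 n | trans (tally-cong c n (λ x p → cong (at (e ∷ s)) (∸-suc p))) (tally-fromRight s c)
  with e Fin.≟ c
... | yes _ = refl
... | no  _ = refl

count₂ count₁ : ∀ {n} → Vec (Fin 3) n → ℕ
count₂ = countᵇ (λ e → does (e Fin.≟ F2))
count₁ = countᵇ (λ e → does (e Fin.≟ F1))

-- s sorted increasingly: the word sortedWord (count₂ s) (count₁ s) read backwards
sortVec : ∀ {n} → Vec (Fin 3) n → Vec (Fin 3) n
sortVec {n} s = tabulate λ k → sortedWord (count₂ s) (count₁ s) (n ∸ suc (toℕ k))

∸-+-∸ : ∀ {a b n} → a ≤ b → b ≤ n → (n ∸ b) + (b ∸ a) ≡ n ∸ a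
∸-+-∸ {a} {b} {n} a≤b b≤n = trans (sym (+-∸-assoc (n ∸ b) a≤b)) (cong (_∸ a) (m∸n+n≡m b≤n))

zeroString-sorted : ∀ {a b n} → a ≤ b → b ≤ n → ∀ k → k < n →
  sortedWord (n ∸ b) (b ∸ a) (n ∸ suc k) ≡ (if suc k ≤ᵇ a then F0 else if suc k ≤ᵇ b then F1 else F2)
zeroString-sorted {a} {b} {n} a≤b b≤n k k<n with suc k ≤? a | suc k ≤? b
... | yes k<a | _ rewrite ≤ᵇ-true k<a =
  sortedWord-0 (n ∸ b) (b ∸ a) (n ∸ suc k) (subst (_≤ n ∸ suc k) (sym (∸-+-∸ a≤b b≤n)) (∸-monoʳ-≤ n k<a))
... | no k≮a | yes k<b rewrite ≤ᵇ-false (≰⇒> k≮a) | ≤ᵇ-true k<b =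
  sortedWord-1 (n ∸ b) (b ∸ a) (n ∸ suc k) (∸-monoʳ-≤ n k<b)
    (subst (n ∸ suc k <_) (sym (∸-+-∸ a≤b b≤n)) (∸-monoʳ-< (≰⇒> k≮a) k<n))
... | no k≮a | no k≮b rewrite ≤ᵇ-false (≰⇒> k≮a) | ≤ᵇ-false (≰⇒> k≮b) =
  sortedWord-2 (n ∸ b) (b ∸ a) (n ∸ suc k) (∸-monoʳ-< (≰⇒> k≮b) k<n)

sortVec-012 : ∀ {a b n} → a ≤ b → b ≤ n → (s : Vec (Fin 3) n) → is012String a b s → sortVec s ≡ zeroString a b n
sortVec-012 a≤b b≤n s (_ , ones , twos) rewrite ones | twos =
  tabulate-cong λ k → zeroString-sorted a≤b b≤n (toℕ k) (toℕ<n k)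

-- Cutting the rhombus along OB

module Bijection {n} (u v w : Vec (Fin 3) n) where

  β : ℕ → Fin 3
  β = fromRight v

  open SortingTriangle β

  v↑ : Vec (Fin 3) n
  v↑ = sortVec v

  right-border : ∀ y → y < n → forcedG n y ≡ str v↑ (n ∸ suc y)
  right-border y y<n = begin
    label (sortedWord (tally β F2 (suc (n ∸ 1))) (tally β F1 (suc (n ∸ 1))) y)
      ≡⟨ cong (λ m → label (sortedWord (tally β F2 m) (tally β F1 m) y)) 1+[n∸1]≡n ⟩
    label (sortedWord (tally β F2 n) (tally β F1 n) y)
      ≡⟨ cong₂ (λ a b → label (sortedWord a b y)) (tally-fromRight v F2) (tally-fromRight v F1) ⟩
    label (sortedWord (count₂ v) (count₁ v) y)
      ≡⟨ cong (λ x → label (sortedWord (count₂ v) (count₁ v) x)) (sym (∸-suc-involutive y<n)) ⟩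
    label (sortedWord (count₂ v) (count₁ v) (n ∸ suc (n ∸ suc y)))
      ≡⟨ cong label (sym (at-tabulate n (λ k → sortedWord (count₂ v) (count₁ v) (n ∸ suc k)) (n ∸ suc y) (∸-suc-< y<n))) ⟩
    label (at v↑ (n ∸ suc y))
      ≡⟨ sym (str-at v↑ (n ∸ suc y)) ⟩
    str v↑ (n ∸ suc y) ∎
    where
    open ≡-Reasoning
    1+[n∸1]≡n : suc (n ∸ 1) ≡ n
    1+[n∸1]≡n = trans (+-comm 1 (n ∸ 1)) (m∸n+n≡m (≤-trans (s≤s z≤n) y<n))

  bottom-border : ∀ x → x < n → label (β x) ≡ str v (n ∸ suc x)
  bottom-border x x<n = sym (str-at v (n ∸ suc x))

  -- Rhombus cells (x , y) with x ≤ y form OAB; the cell (x , y) is the triangle cell (n ∸ suc y , x).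
  ψH ψG ψD : TriLabeling n → Reading
  ψH τ x y = if x <ᵇ y     then triD τ (n ∸ y) x     else forcedH x y
  ψG τ x y = if x <ᵇ suc y then triH τ (n ∸ suc y) x else forcedG x y
  ψD τ x y = if x <ᵇ suc y then triA τ (n ∸ suc y) x else forcedD x y

  ψ : TriLabeling n → RhLabeling n
  ψ τ = rhLab (tabulate₂ (ψH τ)) (tabulate₂ (ψG τ)) (tabulate₂ (ψD τ))

  φH φD φA : RhLabeling n → Reading
  φH X i j = if n ≤ᵇ i + j then zero else rhG X j (n ∸ suc i)
  φD X i j = if n ≤ᵇ i + j then zero else rhH X j (n ∸ i)
  φA X i j = if n ≤ᵇ i + j then zero else rhD X j (n ∸ suc i)

  φ : RhLabeling n → TriLabeling n
  φ X = triLab (tabulate₂ (φH X)) (tabulate₂ (φD X)) (tabulate₂ (φA X))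

  module _ (τ : TriLabeling n) where

    ψH-upper : ∀ {x y} → x < y → y ≤ n → rhH (ψ τ) x y ≡ triD τ (n ∸ y) x
    ψH-upper {x} {y} x<y y≤n = trans (get-tabulate₂ (ψH τ) x y (<-≤-trans x<y y≤n) (s≤s y≤n)) (if-true (<ᵇ-true x<y))

    ψH-lower : ∀ {x y} → y ≤ x → x < n → rhH (ψ τ) x y ≡ forcedH x y
    ψH-lower {x} {y} y≤x x<n = trans (get-tabulate₂ (ψH τ) x y x<n (s≤s (≤-trans y≤x (<⇒≤ x<n)))) (if-false (<ᵇ-false y≤x))

    ψG-upper : ∀ {x y} → x ≤ y → y < n → rhG (ψ τ) x y ≡ triH τ (n ∸ suc y) x
    ψG-upper {x} {y} x≤y y<n = trans (get-tabulate₂ (ψG τ) x y (s≤s (≤-trans x≤y (<⇒≤ y<n))) y<n) (if-true (<ᵇ-true (s≤s x≤y)))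

    ψG-lower : ∀ {x y} → y < x → x ≤ n → rhG (ψ τ) x y ≡ forcedG x y
    ψG-lower {x} {y} y<x x≤n = trans (get-tabulate₂ (ψG τ) x y (s≤s x≤n) (<-≤-trans y<x x≤n)) (if-false (<ᵇ-false y<x))

    ψD-upper : ∀ {x y} → x ≤ y → y < n → rhD (ψ τ) x y ≡ triA τ (n ∸ suc y) x
    ψD-upper {x} {y} x≤y y<n = trans (get-tabulate₂ (ψD τ) x y (≤-<-trans x≤y y<n) y<n) (if-true (<ᵇ-true (s≤s x≤y)))

    ψD-lower : ∀ {x y} → y < x → x < n → rhD (ψ τ) x y ≡ forcedD x y
    ψD-lower {x} {y} y<x x<n = trans (get-tabulate₂ (ψD τ) x y x<n (<-trans y<x x<n)) (if-false (<ᵇ-false y<x))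

  module _ (X : RhLabeling n) where

    φH-inside : ∀ {i j} → i + j < n → triH (φ X) i j ≡ rhG X j (n ∸ suc i)
    φH-inside {i} {j} i+j<n = trans (get-tabulate₂ (φH X) i j (+<⇒ˡ< i+j<n) (+<⇒ʳ< i+j<n)) (if-false (≤ᵇ-false i+j<n))

    φD-inside : ∀ {i j} → i + j < n → triD (φ X) i j ≡ rhH X j (n ∸ i)
    φD-inside {i} {j} i+j<n = trans (get-tabulate₂ (φD X) i j (+<⇒ˡ< i+j<n) (+<⇒ʳ< i+j<n)) (if-false (≤ᵇ-false i+j<n))

    φA-inside : ∀ {i j} → i + j < n → triA (φ X) i j ≡ rhD X j (n ∸ suc i)
    φA-inside {i} {j} i+j<n = trans (get-tabulate₂ (φA X) i j (+<⇒ˡ< i+j<n) (+<⇒ʳ< i+j<n)) (if-false (≤ᵇ-false i+j<n))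

    φ-outside : ∀ i j → i < n → j < n → n ≤ i + j →
                triH (φ X) i j ≡ zero × triD (φ X) i j ≡ zero × triA (φ X) i j ≡ zero
    φ-outside i j i<n j<n n≤i+j =
      trans (get-tabulate₂ (φH X) i j i<n j<n) (if-true (≤ᵇ-true n≤i+j)) ,
      trans (get-tabulate₂ (φD X) i j i<n j<n) (if-true (≤ᵇ-true n≤i+j)) ,
      trans (get-tabulate₂ (φA X) i j i<n j<n) (if-true (≤ᵇ-true n≤i+j))

  ψ-puzzle : ∀ τ → TriPuzzle u v w (triH τ) (triD τ) (triA τ) →
             RhPuzzle u v↑ v w (rhH (ψ τ)) (rhG (ψ τ)) (rhD (ψ τ))
  ψ-puzzle τ P = record { up = up' ; down = down' ; top = top' ; right = right' ; bottom = bottom' ; left = left' }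
    where
    open TriPuzzle P
    diagonal-eq : ∀ x → x < n → forcedD x x ≡ rhD (ψ τ) x x
    diagonal-eq x x<n = begin
      forcedD x x                                     ≡⟨ forced-diagonal x ⟩
      label (β x)                                     ≡⟨ bottom-border x x<n ⟩
      str v (n ∸ suc x)                               ≡⟨ sym (right (n ∸ suc x) (∸-suc-< x<n)) ⟩
      triA τ (n ∸ suc x) (n ∸ suc (n ∸ suc x))        ≡⟨ cong (triA τ (n ∸ suc x)) (∸-suc-involutive x<n) ⟩
      triA τ (n ∸ suc x) x                            ≡⟨ sym (ψD-upper τ ≤-refl x<n) ⟩
      rhD (ψ τ) x x                                   ∎
      where open ≡-Reasoning
    up' : ∀ x y → x < n → y < n → Admissible (rhD (ψ τ) x y) (rhG (ψ τ) (suc x) y) (rhH (ψ τ) x y)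
    up' x y x<n y<n with <-cmp x y
    ... | tri< x<y _ _ =
      subst-admissible (sym (ψD-upper τ (<⇒≤ x<y) y<n)) (sym (ψG-upper τ x<y y<n))
        (trans (cong (λ i → triD τ i x) (sym (∸-suc y<n))) (sym (ψH-upper τ x<y (<⇒≤ y<n))))
        (admissible-rotate (admissible-rotate
          (down (n ∸ suc y) x (subst (_≤ n) (cong suc (+-suc (n ∸ suc y) x)) (∸-suc-+-< x<y y<n)))))
    ... | tri≈ _ refl _ =
      subst-admissible (diagonal-eq x x<n) (sym (ψG-lower τ (n<1+n x) x<n)) (sym (ψH-lower τ ≤-refl x<n)) (forced-up x x)
    ... | tri> _ _ y<x =
      subst-admissible (sym (ψD-lower τ y<x x<n)) (sym (ψG-lower τ (m<n⇒m<1+n y<x) x<n)) (sym (ψH-lower τ (<⇒≤ y<x) x<n))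
        (forced-up x y)
    down-lower : ∀ x y → y < x → x < n → Admissible (rhH (ψ τ) x (suc y)) (rhD (ψ τ) x y) (rhG (ψ τ) x y)
    down-lower (suc x) y y<x x<n =
      subst-admissible (sym (ψH-lower τ y<x x<n)) (sym (ψD-lower τ y<x x<n)) (sym (ψG-lower τ y<x (<⇒≤ x<n)))
        (forced-down x y)
    down' : ∀ x y → x < n → y < n → Admissible (rhH (ψ τ) x (suc y)) (rhD (ψ τ) x y) (rhG (ψ τ) x y)
    down' x y x<n y<n with x ≤? y
    ... | yes x≤y =
      subst-admissible (sym (ψH-upper τ (s≤s x≤y) y<n)) (sym (ψD-upper τ x≤y y<n)) (sym (ψG-upper τ x≤y y<n))
        (up (n ∸ suc y) x (∸-suc-+-< x≤y y<n))
    ... | no x≰y = down-lower x y (≰⇒> x≰y) x<n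
    top' : ∀ k → k < n → rhH (ψ τ) k n ≡ str u k
    top' k k<n = trans (ψH-upper τ k<n ≤-refl) (trans (cong (λ i → triD τ i k) (n∸n≡0 n)) (left k k<n))
    right' : ∀ k → k < n → rhG (ψ τ) n (n ∸ suc k) ≡ str v↑ k
    right' k k<n = trans (ψG-lower τ (∸-suc-< k<n) ≤-refl)
      (trans (right-border (n ∸ suc k) (∸-suc-< k<n)) (cong (str v↑) (∸-suc-involutive k<n)))
    bottom' : ∀ k → k < n → rhH (ψ τ) (n ∸ suc k) 0 ≡ str v k
    bottom' k k<n = trans (ψH-lower τ z≤n (∸-suc-< k<n)) (trans (forced-bottom (n ∸ suc k))
      (trans (bottom-border (n ∸ suc k) (∸-suc-< k<n)) (cong (str v) (∸-suc-involutive k<n))))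
    left' : ∀ k → k < n → rhG (ψ τ) 0 (n ∸ suc k) ≡ str w k
    left' k k<n = trans (ψG-upper τ z≤n (∸-suc-< k<n)) (trans (cong (λ i → triH τ i 0) (∸-suc-involutive k<n)) (bottom k k<n))

  module LowerTriangle (X : RhLabeling n) (P : RhPuzzle u v↑ v w (rhH X) (rhG X) (rhD X)) where
    open RhPuzzle P

    right-forced : ∀ y → y < n → rhG X n y ≡ forcedG n y
    right-forced y y<n = trans (cong (rhG X n) (sym (∸-suc-involutive y<n)))
      (trans (right (n ∸ suc y) (∸-suc-< y<n)) (sym (right-border y y<n)))

    bottom-forced : ∀ x → x < n → rhH X x 0 ≡ label (β x)
    bottom-forced x x<n = trans (cong (λ i → rhH X i 0) (sym (∸-suc-involutive x<n)))
      (trans (bottom (n ∸ suc x) (∸-suc-< x<n)) (sym (bottom-border x x<n)))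

    open SortingTriangleUnique β n (rhH X) (rhG X) (rhD X)
      (λ x y y≤x x<n → up x y x<n (≤-<-trans y≤x x<n)) (λ x y y<x x<n → down x y x<n (<-trans y<x x<n))
      right-forced bottom-forced public

  φ-puzzle : ∀ X → RhPuzzle u v↑ v w (rhH X) (rhG X) (rhD X) → TriPuzzle u v w (triH (φ X)) (triD (φ X)) (triA (φ X))
  φ-puzzle X P = record
    { up      = λ i j i+j<n → subst-admissible (sym (φD-inside X i+j<n)) (sym (φA-inside X i+j<n)) (sym (φH-inside X i+j<n))
                  (subst-admissible (cong (rhH X j) (sym (∸-suc (+<⇒ˡ< i+j<n)))) refl refl
                    (down j (n ∸ suc i) (+<⇒ʳ< i+j<n) (∸-suc-< (+<⇒ˡ< i+j<n))))
    ; down    = λ i j 2+i+j≤n → let i+j<n = <-trans (n<1+n _) 2+i+j≤n in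
                  subst-admissible (sym (φH-inside X (subst (_< n) (sym (+-suc i j)) 2+i+j≤n))) (sym (φD-inside X 2+i+j≤n))
                    (sym (φA-inside X i+j<n))
                    (admissible-rotate (up j (n ∸ suc i) (+<⇒ʳ< i+j<n) (∸-suc-< (+<⇒ˡ< i+j<n))))
    ; outside = φ-outside X
    ; left    = λ k k<n → trans (φD-inside X k<n) (top k k<n)
    ; right   = λ k k<n → right' k k<n
    ; bottom  = λ k k<n → trans (φH-inside X (subst (_< n) (sym (+-identityʳ k)) k<n)) (left k k<n)
    }
    where
    open RhPuzzle P
    open LowerTriangle X P using (dr-forced)
    right' : ∀ k → k < n → triA (φ X) k (n ∸ suc k) ≡ str v k
    right' k k<n = begin
      triA (φ X) k (n ∸ suc k)             ≡⟨ φA-inside X (≤-reflexive (m+[n∸m]≡n k<n)) ⟩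
      rhD X (n ∸ suc k) (n ∸ suc k)        ≡⟨ dr-forced (n ∸ suc k) (n ∸ suc k) ≤-refl (∸-suc-< k<n) ⟩
      forcedD (n ∸ suc k) (n ∸ suc k)      ≡⟨ forced-diagonal (n ∸ suc k) ⟩
      label (β (n ∸ suc k))                ≡⟨ bottom-border (n ∸ suc k) (∸-suc-< k<n) ⟩
      str v (n ∸ suc (n ∸ suc k))          ≡⟨ cong (str v) (∸-suc-involutive k<n) ⟩
      str v k                              ∎
      where open ≡-Reasoning

  φψ≃id : ∀ τ → TriPuzzle u v w (triH τ) (triD τ) (triA τ) → triReadings (φ (ψ τ)) ≃ triReadings τ
  φψ≃id τ P = get-≗₂ _ _ H= , get-≗₂ _ _ D= , get-≗₂ _ _ A=
    where
    open TriPuzzle P using (outside)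
    H= : ∀ i j → i < n → j < n → triH (φ (ψ τ)) i j ≡ triH τ i j
    H= i j i<n j<n with i + j <? n
    ... | yes i+j<n = trans (φH-inside (ψ τ) i+j<n) (trans (ψG-upper τ (+<⇒≤∸-suc i+j<n) (∸-suc-< i<n))
                        (cong (λ i' → triH τ i' j) (∸-suc-involutive i<n)))
    ... | no i+j≮n = let n≤i+j = ≮⇒≥ i+j≮n in
                     trans (proj₁ (φ-outside (ψ τ) i j i<n j<n n≤i+j)) (sym (proj₁ (outside i j i<n j<n n≤i+j)))
    D= : ∀ i j → i < n → j < n → triD (φ (ψ τ)) i j ≡ triD τ i j
    D= i j i<n j<n with i + j <? n
    ... | yes i+j<n = trans (φD-inside (ψ τ) i+j<n) (trans (ψH-upper τ (+<⇒<∸ i+j<n) (m∸n≤m n i))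
                        (cong (λ i' → triD τ i' j) (m∸[m∸n]≡n (<⇒≤ i<n))))
    ... | no i+j≮n = let n≤i+j = ≮⇒≥ i+j≮n in
                     trans (proj₁ (proj₂ (φ-outside (ψ τ) i j i<n j<n n≤i+j))) (sym (proj₁ (proj₂ (outside i j i<n j<n n≤i+j))))
    A= : ∀ i j → i < n → j < n → triA (φ (ψ τ)) i j ≡ triA τ i j
    A= i j i<n j<n with i + j <? n
    ... | yes i+j<n = trans (φA-inside (ψ τ) i+j<n) (trans (ψD-upper τ (+<⇒≤∸-suc i+j<n) (∸-suc-< i<n))
                        (cong (λ i' → triA τ i' j) (∸-suc-involutive i<n)))
    ... | no i+j≮n = let n≤i+j = ≮⇒≥ i+j≮n in
                     trans (proj₂ (proj₂ (φ-outside (ψ τ) i j i<n j<n n≤i+j))) (sym (proj₂ (proj₂ (outside i j i<n j<n n≤i+j))))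

  ψφ≃id : ∀ X → RhPuzzle u v↑ v w (rhH X) (rhG X) (rhD X) → rhReadings (ψ (φ X)) ≃ rhReadings X
  ψφ≃id X P = get-≗₂ _ _ H= , get-≗₂ _ _ G= , get-≗₂ _ _ D=
    where
    open LowerTriangle X P using (hr-forced; gr-forced; dr-forced)
    H= : ∀ x y → x < n → y < suc n → rhH (ψ (φ X)) x y ≡ rhH X x y
    H= x y x<n (s≤s y≤n) with x <? y
    ... | yes x<y = trans (ψH-upper (φ X) x<y y≤n) (trans (φD-inside X (∸-+-< x<y y≤n)) (cong (rhH X x) (m∸[m∸n]≡n y≤n)))
    ... | no x≮y  = trans (ψH-lower (φ X) (≮⇒≥ x≮y) x<n) (sym (hr-forced x y (≮⇒≥ x≮y) x<n))
    G= : ∀ x y → x < suc n → y < n → rhG (ψ (φ X)) x y ≡ rhG X x y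
    G= x y (s≤s x≤n) y<n with x ≤? y
    ... | yes x≤y = trans (ψG-upper (φ X) x≤y y<n) (trans (φH-inside X (∸-suc-+-< x≤y y<n)) (cong (rhG X x) (∸-suc-involutive y<n)))
    ... | no x≰y  = trans (ψG-lower (φ X) (≰⇒> x≰y) x≤n) (sym (gr-forced x y (≰⇒> x≰y) x≤n))
    D= : ∀ x y → x < n → y < n → rhD (ψ (φ X)) x y ≡ rhD X x y
    D= x y x<n y<n with x ≤? y
    ... | yes x≤y = trans (ψD-upper (φ X) x≤y y<n) (trans (φA-inside X (∸-suc-+-< x≤y y<n)) (cong (rhD X x) (∸-suc-involutive y<n)))
    ... | no x≰y  = trans (ψD-lower (φ X) (≰⇒> x≰y) x<n) (sym (dr-forced x y (<⇒≤ (≰⇒> x≰y)) x<n))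

  ψ-cong : ∀ {τ τ'} → triReadings τ ≃ triReadings τ' → rhReadings (ψ τ) ≃ rhReadings (ψ τ')
  ψ-cong (H= , D= , A=) =
    tabulate₂-cong {n} {suc n} (λ x y → cong (λ h → if x <ᵇ y then h else forcedH x y) (D= (n ∸ y) x)) ,
    tabulate₂-cong {suc n} {n} (λ x y → cong (λ g → if x <ᵇ suc y then g else forcedG x y) (H= (n ∸ suc y) x)) ,
    tabulate₂-cong {n} {n} (λ x y → cong (λ d → if x <ᵇ suc y then d else forcedD x y) (A= (n ∸ suc y) x))

  φ-cong : ∀ {X X'} → rhReadings X ≃ rhReadings X' → triReadings (φ X) ≃ triReadings (φ X')
  φ-cong (H= , G= , D=) =
    tabulate₂-cong {n} {n} (λ i j → cong (λ h → if n ≤ᵇ i + j then zero else h) (G= j (n ∸ suc i))) ,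
    tabulate₂-cong {n} {n} (λ i j → cong (λ d → if n ≤ᵇ i + j then zero else d) (H= j (n ∸ i))) ,
    tabulate₂-cong {n} {n} (λ i j → cong (λ a → if n ≤ᵇ i + j then zero else a) (D= j (n ∸ suc i)))

  puzzle-relation : ∀ τ X → (isTriPuzzle u v w τ ∧ X ≈R ψ τ) ≡ (isRhPuzzle u v↑ v w X ∧ τ ≈T φ X)
  puzzle-relation τ X = Bool-ext forward backward
    where
    forward : T (isTriPuzzle u v w τ ∧ X ≈R ψ τ) → T (isRhPuzzle u v↑ v w X ∧ τ ≈T φ X)
    forward p =
      let (tri , X≈ψτ) = ∧-split {isTriPuzzle u v w τ} p
          P = isTriPuzzle⇒TriPuzzle tri
          ψτ≃X = ≃-sym (≈R⇒≃ X (ψ τ) X≈ψτ)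
      in ∧-intro (RhPuzzle⇒isRhPuzzle (RhPuzzle-transport ψτ≃X (ψ-puzzle τ P)))
                 (≃⇒≈T τ (φ X) (≃-trans (≃-sym (φψ≃id τ P)) (φ-cong ψτ≃X)))
    backward : T (isRhPuzzle u v↑ v w X ∧ τ ≈T φ X) → T (isTriPuzzle u v w τ ∧ X ≈R ψ τ)
    backward p =
      let (rh , τ≈φX) = ∧-split {isRhPuzzle u v↑ v w X} p
          P = isRhPuzzle⇒RhPuzzle rh
          φX≃τ = ≃-sym (≈T⇒≃ τ (φ X) τ≈φX)
      in ∧-intro (TriPuzzle⇒isTriPuzzle (TriPuzzle-transport φX≃τ (φ-puzzle X P)))
                 (≃⇒≈R X (ψ τ) (≃-trans (≃-sym (ψφ≃id X P)) (ψ-cong φX≃τ)))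

  puzzles-equinumerous : count (isTriPuzzle u v w) (allTriLabelings n) ≡ count (isRhPuzzle u v↑ v w) (allRhLabelings n)
  puzzles-equinumerous = double-counting (allTriLabelings n) (allRhLabelings n) _ _ (λ τ X → isTriPuzzle u v w τ ∧ X ≈R ψ τ)
    (λ τ → count-∧-once (allRhLabelings n) (isTriPuzzle u v w τ) (_≈R ψ τ) (allRhLabelings-once n (ψ τ)))
    (λ X → trans (∑-cong (allTriLabelings n) (λ τ → cong 𝟙 (puzzle-relation τ X)))
                 (count-∧-once (allTriLabelings n) (isRhPuzzle u v↑ v w X) (_≈T φ X) (allTriLabelings-once n (φ X))))

C≡numRhPuzzles-sortVec : ∀ {n} (u v w : Vec (Fin 3) n) → C w u v ≡ numRhPuzzles u (sortVec v) v w
C≡numRhPuzzles-sortVec {n} u v w = begin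
  C w u v                                                      ≡⟨ length-filterᵇ _ (allTriLabelings n) ⟩
  count (isTriPuzzle u v w) (allTriLabelings n)                ≡⟨ Bijection.puzzles-equinumerous u v w ⟩
  count (isRhPuzzle u (sortVec v) v w) (allRhLabelings n)      ≡⟨ sym (length-filterᵇ _ (allRhLabelings n)) ⟩
  numRhPuzzles u (sortVec v) v w                               ∎
  where open ≡-Reasoning

corollary3p3 : (a b n : ℕ) → a ≤ b → b ≤ n →
    (u v w : Vec (Fin 3) n) →
    is012String a b u → is012String a b v → is012String a b w →
    C w u v ≡ numRhPuzzles u (zeroString a b n) v w
corollary3p3 a b n a≤b b≤n u v w _ v-012 _ =
  trans (C≡numRhPuzzles-sortVec u v w) (cong (λ r → numRhPuzzles u r v w) (sortVec-012 a≤b b≤n v v-012))
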